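{- If $d$ is a derivation in $\mathrm{BI}^\Omega$ and $\Gamma(d)$ is a $\Pi^1$-sequent, then there exists a derivation $d'$ in $\mathrm{BI}^\Omega_0$ with $\Gamma(d')=\Gamma(d)$.
   Context: Language $L$: terms are built from $0$ by successor $S$; atomic formulas are $R(t_1,\dots,t_n)$ ($R$ a symbol for an $n$-ary primitive recursive relation) and $X(t)$ ($X$ a unary set variable); literals are atomic formulas and their negations. Formulas are built from literals by $\wedge,\vee$, number quantifiers ($\forall xA(x),\exists xA(x)$ are formulas when $A(0)$ is; formulas have no free number variables) and $\forall XA,\exists XA$, allowed only when $A$ has no second-order quantifier and no free set variable other than $X$. Negation of non-atomic formulas is by De Morgan's laws. TRUE is the set of true closed literals $R(\vec n)$, $\neg R(\vec n)$. A $\Pi^1$-formula has no subformula of the form $\exists XA(X)$; a $\Pi^1$-sequent is a finite set of $\Pi^1$-formulas. Sequents are finite sets; $\Gamma,A=\Gamma\cup\{A\}$. Derivations: each inference symbol $I$ has principal formulas $\Delta(I)$, index set $|I|$, minor formulas $\Delta_i(I)$ ($i\in|I|$). A derivation $d=I(d_i)_{i\in|I|}$ is a well-founded (possibly infinitely branching) labelled tree with end-sequent $\Gamma(d)$ such that $\Delta(I)\subseteq\Gamma(d)$ and $\Gamma(d_i)\subseteq\Gamma(d)\cup\Delta_i(I)$ for all $i$; eigenvariables do not occur free in the conclusion of their inference. $\mathrm{BI}^\Omega_0$ has the rules: $\mathrm{Ax}_\Delta$ (no premises) with $\Delta=\{A\}\subseteq$ TRUE or $\Delta=\{C,\neg C\}$;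 $\bigwedge_{A_0\wedge A_1}$ (premises $A_0$, $A_1$); $\bigvee^k_{A_0\vee A_1}$, $k\in\{0,1\}$ (premise $A_k$); $\bigwedge_{\forall xA}$ (premises $A(\bar n)$ for all $n\in\omega$); $\bigvee^k_{\exists xA}$, $k\in\omega$ (premise $A(\bar k)$); $\bigwedge_{\forall XA}$ (premise $A(X/Y)$, $Y$ an eigenvariable); $\mathrm{Cut}_A$ ($\Delta=\emptyset$, premises with minor formulas $A$ and $\neg A$); $\mathrm{Rep}$ ($\Delta=\emptyset$, one premise with no minor formula). In each case the principal formula is the displayed conclusion formula. $\mathrm{BI}^\Omega$ adds two rules. Let $|\forall XA(X)|$ be the set of pairs $q=(e,Z)$ where $e$ is a derivation in $\mathrm{BI}^\Omega_0$ containing no Cut, $\Gamma(e)$ is a $\Pi^1$-sequent, $Z$ is a set variable, and $Z$ is not free in $\Delta_q:=\Gamma(e)\setminus\{A(Z)\}$. Rule $\Omega_{\neg\forall XA}$: $\Delta=\{\neg\forall XA\}$, index set $|\forall XA(X)|$, minor formulas $\Delta_q$ for premise $q$. Rule $\widetilde\Omega^Y_{\neg\forall XA}$: $\Delta=\emptyset$, index set $\{0\}\cup|\forall XA(X)|$, minor formulas $\{A(Y)\}$ for premise $0$ ($Y$ an eigenvariable) and $\Delta_q$ for premise $q$. -}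

module Defs where

open import Data.Nat using (ℕ; zero; suc)
open import Data.Fin using (Fin; zero; suc)
open import Data.Vec using (Vec; []; _∷_; map; tabulate)
open import Data.Bool using (Bool; true; false; T; if_then_else_)
open import Data.Unit using (⊤)
open import Data.Empty using (⊥)
open import Data.Product using (Σ; _×_)
open import Data.Sum using (_⊎_; inj₁; inj₂)
open import Data.List using (List)
open import Data.List.Membership.Propositional using (_∈_)
open import Data.List.Relation.Unary.All using (All)
open import Relation.Binary.PropositionalEquality using (_≡_; _≢_)
open import Relation.Nullary using (¬_)

-- Primitive recursive functions (codes) and their evaluation.
-- An n-ary relation symbol is a code f : PR n; R_f(ns) holds iff
-- eval f ns ≢ 0.  Every primitive recursive relation has a symbol.

data PR : ℕ → Set where
  zer  : ∀ {k} → PR k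
  succ : PR 1
  proj : ∀ {k} → Fin k → PR k
  comp : ∀ {k m} → PR m → (Fin m → PR k) → PR k
  rec  : ∀ {k} → PR k → PR (suc (suc k)) → PR (suc k)

mutual
  eval : ∀ {k} → PR k → Vec ℕ k → ℕ
  eval zer xs = 0
  eval succ (x ∷ []) = suc x
  eval (proj i) xs = Data.Vec.lookup xs i
  eval (comp f gs) xs = eval f (tabulate (λ i → eval (gs i) xs))
  eval (rec g h) (y ∷ xs) = evalRec g h y xs

  evalRec : ∀ {k} → PR k → PR (suc (suc k)) → ℕ → Vec ℕ k → ℕ
  evalRec g h zero xs = eval g xs
  evalRec g h (suc y) xs = eval h (y ∷ evalRec g h y xs ∷ xs)

-- Terms: built from 0 by S, with number variables as de Bruijn indices
-- (n = number of number variables bound in scope).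

data Tm (n : ℕ) : Set where
  var : Fin n → Tm n
  zer : Tm n
  S   : Tm n → Tm n

num : ∀ {n} → ℕ → Tm n
num zero = zer
num (suc k) = S (num k)

val : Tm 0 → ℕ
val (var ())
val zer = 0
val (S t) = suc (val t)

SVar : Set
SVar = ℕ

-- Bodies of second-order quantifiers: formulas with no second-order
-- quantifier whose only set variable is the bound one X
-- (atoms "X(t)" / "¬X(t)").

data Body (n : ℕ) : Set where
  rel  : ∀ {k} → PR k → Vec (Tm n) k → Body n
  nrel : ∀ {k} → PR k → Vec (Tm n) k → Body n
  memX  : Tm n → Body n
  nmemX : Tm n → Body n
  _⋀_ : Body n → Body n → Body n
  _⋁_ : Body n → Body n → Body n
  all : Body (suc n) → Body n
  ex  : Body (suc n) → Body n

-- Formulas (Fm 0 = formulas proper, i.e. without free number variables).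
data Fm (n : ℕ) : Set where
  rel  : ∀ {k} → PR k → Vec (Tm n) k → Fm n
  nrel : ∀ {k} → PR k → Vec (Tm n) k → Fm n
  mem  : SVar → Tm n → Fm n
  nmem : SVar → Tm n → Fm n
  _⋀_ : Fm n → Fm n → Fm n
  _⋁_ : Fm n → Fm n → Fm n
  all : Fm (suc n) → Fm n
  ex  : Fm (suc n) → Fm n
  all2 : Body n → Fm n
  ex2  : Body n → Fm n

negB : ∀ {n} → Body n → Body n
negB (rel f ts) = nrel f ts
negB (nrel f ts) = rel f ts
negB (memX t) = nmemX t
negB (nmemX t) = memX t
negB (A ⋀ B) = negB A ⋁ negB B
negB (A ⋁ B) = negB A ⋀ negB B
negB (all A) = ex (negB A)
negB (ex A) = all (negB A)

neg : ∀ {n} → Fm n → Fm n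
neg (rel f ts) = nrel f ts
neg (nrel f ts) = rel f ts
neg (mem X t) = nmem X t
neg (nmem X t) = mem X t
neg (A ⋀ B) = neg A ⋁ neg B
neg (A ⋁ B) = neg A ⋀ neg B
neg (all A) = ex (neg A)
neg (ex A) = all (neg A)
neg (all2 A) = ex2 (negB A)
neg (ex2 A) = all2 (negB A)

inst : ∀ {n} → SVar → Body n → Fm n
inst Y (rel f ts) = rel f ts
inst Y (nrel f ts) = nrel f ts
inst Y (memX t) = mem Y t
inst Y (nmemX t) = nmem Y t
inst Y (A ⋀ B) = inst Y A ⋀ inst Y B
inst Y (A ⋁ B) = inst Y A ⋁ inst Y B
inst Y (all A) = all (inst Y A)
inst Y (ex A) = ex (inst Y A)

renT : ∀ {n m} → (Fin n → Fin m) → Tm n → Tm m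
renT ρ (var i) = var (ρ i)
renT ρ zer = zer
renT ρ (S t) = S (renT ρ t)

subT : ∀ {n m} → (Fin n → Tm m) → Tm n → Tm m
subT σ (var i) = σ i
subT σ zer = zer
subT σ (S t) = S (subT σ t)

lift : ∀ {n m} → (Fin n → Tm m) → Fin (suc n) → Tm (suc m)
lift σ zero = var zero
lift σ (suc i) = renT suc (σ i)

subB : ∀ {n m} → (Fin n → Tm m) → Body n → Body m
subB σ (rel f ts) = rel f (map (subT σ) ts)
subB σ (nrel f ts) = nrel f (map (subT σ) ts)
subB σ (memX t) = memX (subT σ t)
subB σ (nmemX t) = nmemX (subT σ t)
subB σ (A ⋀ B) = subB σ A ⋀ subB σ B
subB σ (A ⋁ B) = subB σ A ⋁ subB σ B
subB σ (all A) = all (subB (lift σ) A)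
subB σ (ex A) = ex (subB (lift σ) A)

subF : ∀ {n m} → (Fin n → Tm m) → Fm n → Fm m
subF σ (rel f ts) = rel f (map (subT σ) ts)
subF σ (nrel f ts) = nrel f (map (subT σ) ts)
subF σ (mem X t) = mem X (subT σ t)
subF σ (nmem X t) = nmem X (subT σ t)
subF σ (A ⋀ B) = subF σ A ⋀ subF σ B
subF σ (A ⋁ B) = subF σ A ⋁ subF σ B
subF σ (all A) = all (subF (lift σ) A)
subF σ (ex A) = ex (subF (lift σ) A)
subF σ (all2 A) = all2 (subB σ A)
subF σ (ex2 A) = ex2 (subB σ A)

_[_] : Fm 1 → ℕ → Fm 0
A [ k ] = subF (λ { zero → num k }) A

_∈fv_ : ∀ {n} → SVar → Fm n → Set
Y ∈fv rel f ts = ⊥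
Y ∈fv nrel f ts = ⊥
Y ∈fv mem X t = Y ≡ X
Y ∈fv nmem X t = Y ≡ X
Y ∈fv (A ⋀ B) = Y ∈fv A ⊎ Y ∈fv B
Y ∈fv (A ⋁ B) = Y ∈fv A ⊎ Y ∈fv B
Y ∈fv all A = Y ∈fv A
Y ∈fv ex A = Y ∈fv A
Y ∈fv all2 A = ⊥
Y ∈fv ex2 A = ⊥

Pi1 : ∀ {n} → Fm n → Set
Pi1 (rel f ts) = ⊤
Pi1 (nrel f ts) = ⊤
Pi1 (mem X t) = ⊤
Pi1 (nmem X t) = ⊤
Pi1 (A ⋀ B) = Pi1 A × Pi1 B
Pi1 (A ⋁ B) = Pi1 A × Pi1 B
Pi1 (all A) = Pi1 A
Pi1 (ex A) = Pi1 A
Pi1 (all2 A) = ⊤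
Pi1 (ex2 A) = ⊥

TRUE : Fm 0 → Set
TRUE (rel f ts) = ¬ (eval f (map val ts) ≡ 0)
TRUE (nrel f ts) = eval f (map val ts) ≡ 0
TRUE _ = ⊥

-- Sequents: finite sets of formulas, represented by lists (only
-- membership is ever used, so lists are read as finite sets).

Seq : Set
Seq = List (Fm 0)

Pi1Seq : Seq → Set
Pi1Seq Γ = All Pi1 Γ

NotFreeIn : SVar → Seq → Set
NotFreeIn Y Γ = All (λ B → ¬ (Y ∈fv B)) Γ

-- Abstract inference symbols: principal formulas Δ(I), index set |I|,
-- minor formulas Δ_i(I), and the eigenvariable side condition on the
-- conclusion.

record Rules : Set₁ where
  field
    Sym   : Set
    prin  : Sym → Fm 0 → Set
    Idx   : Sym → Set
    minor : (I : Sym) → Idx I → Fm 0 → Set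
    side  : Sym → Seq → Set
open Rules public

-- Derivations d = I(d_i)_{i ∈ |I|}: well-founded trees with end-sequent
-- Γ(d) (the index), Δ(I) ⊆ Γ(d), Γ(d_i) ⊆ Γ(d) ∪ Δ_i(I).
data Der (R : Rules) : Seq → Set where
  node : ∀ {Γ} (I : Sym R)
       → (∀ {A} → prin R I A → A ∈ Γ)
       → side R I Γ
       → (Γs : Idx R I → Seq)
       → ((i : Idx R I) → Der R (Γs i))
       → ((i : Idx R I) → ∀ {A} → A ∈ Γs i → A ∈ Γ ⊎ minor R I i A)
       → Der R Γ

-- BI^Ω_0 (with Cut iff the flag c is true)

data Sym0 (c : Bool) : Set where
  axT  : (A : Fm 0) → TRUE A → Sym0 c
  axC  : (C : Fm 0) → Sym0 c
  andI : Fm 0 → Fm 0 → Sym0 c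
  orI  : Bool → Fm 0 → Fm 0 → Sym0 c           -- ⋁^k_{A0∨A1} (false = 0, true = 1)
  allI : Fm 1 → Sym0 c
  exI  : ℕ → Fm 1 → Sym0 c
  all2I : Body 0 → SVar → Sym0 c
  cutI : T c → Fm 0 → Sym0 c
  rep  : Sym0 c

pick : Bool → Fm 0 → Fm 0 → Fm 0
pick false A₀ A₁ = A₀
pick true  A₀ A₁ = A₁

prin0 : ∀ {c} → Sym0 c → Fm 0 → Set
prin0 (axT A _) B = B ≡ A
prin0 (axC C) B = B ≡ C ⊎ B ≡ neg C
prin0 (andI A₀ A₁) B = B ≡ (A₀ ⋀ A₁)
prin0 (orI k A₀ A₁) B = B ≡ (A₀ ⋁ A₁)
prin0 (allI A) B = B ≡ all A
prin0 (exI k A) B = B ≡ ex A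
prin0 (all2I A Y) B = B ≡ all2 A
prin0 (cutI _ A) B = ⊥
prin0 rep B = ⊥

Idx0 : ∀ {c} → Sym0 c → Set
Idx0 (axT _ _) = ⊥
Idx0 (axC _) = ⊥
Idx0 (andI _ _) = Bool
Idx0 (orI _ _ _) = ⊤
Idx0 (allI _) = ℕ
Idx0 (exI _ _) = ⊤
Idx0 (all2I _ _) = ⊤
Idx0 (cutI _ _) = Bool
Idx0 rep = ⊤

minor0 : ∀ {c} (I : Sym0 c) → Idx0 I → Fm 0 → Set
minor0 (axT _ _) ()
minor0 (axC _) ()
minor0 (andI A₀ A₁) b B = B ≡ pick b A₀ A₁
minor0 (orI k A₀ A₁) _ B = B ≡ pick k A₀ A₁
minor0 (allI A) n B = B ≡ A [ n ]
minor0 (exI k A) _ B = B ≡ A [ k ]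
minor0 (all2I A Y) _ B = B ≡ inst Y A
minor0 (cutI _ A) true B = B ≡ A
minor0 (cutI _ A) false B = B ≡ neg A
minor0 rep _ B = ⊥

side0 : ∀ {c} → Sym0 c → Seq → Set
side0 (all2I A Y) Γ = NotFreeIn Y Γ
side0 _ Γ = ⊤

BI0rules : Bool → Rules
BI0rules c = record { Sym = Sym0 c ; prin = prin0 ; Idx = Idx0 ; minor = minor0 ; side = side0 }

BI0 : Rules
BI0 = BI0rules true

BI0cf : Rules
BI0cf = BI0rules false

-- |∀X A(X)|: pairs q = (e, Z), e a cut-free BI^Ω_0 derivation of a
-- Π¹-sequent, Z not free in Δ_q = Γ(e) \ {A(Z)}.
record OmIdx (A : Body 0) : Set where
  field
    Γe   : Seq
    e    : Der BI0cf Γe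
    pi1  : Pi1Seq Γe
    Z    : SVar
    free : ∀ B → B ∈ Γe → B ≢ inst Z A → ¬ (Z ∈fv B)
open OmIdx public

Δq : (A : Body 0) → OmIdx A → Fm 0 → Set
Δq A q B = B ∈ Γe q × B ≢ inst (Z q) A

data SymΩ : Set where
  base   : Sym0 true → SymΩ
  omega  : Body 0 → SymΩ
  omegaT : Body 0 → SVar → SymΩ

prinΩ : SymΩ → Fm 0 → Set
prinΩ (base I) = prin0 I
prinΩ (omega A) B = B ≡ neg (all2 A)
prinΩ (omegaT A Y) B = ⊥

IdxΩ : SymΩ → Set
IdxΩ (base I) = Idx0 I
IdxΩ (omega A) = OmIdx A
IdxΩ (omegaT A Y) = ⊤ ⊎ OmIdx A

minorΩ : (I : SymΩ) → IdxΩ I → Fm 0 → Set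
minorΩ (base I) i = minor0 I i
minorΩ (omega A) q = Δq A q
minorΩ (omegaT A Y) (inj₁ _) B = B ≡ inst Y A
minorΩ (omegaT A Y) (inj₂ q) = Δq A q

sideΩ : SymΩ → Seq → Set
sideΩ (base I) = side0 I
sideΩ (omega A) Γ = ⊤
sideΩ (omegaT A Y) Γ = NotFreeIn Y Γ

BIΩ : Rules
BIΩ = record { Sym = SymΩ ; prin = prinΩ ; Idx = IdxΩ ; minor = minorΩ ; side = sideΩ }

-- BI^Ω is embedded into a calculus whose sequents are predicates on formulas and whose
-- ∀X-inferences have a premise for every eigenvariable outside a finite list; the single
-- eigenvariable of a BI^Ω-inference is moved to any fresh one by renaming the subderivation
-- along a transposition, and an Ω-inference is renamed by renaming its indices backwards.
-- There cuts are eliminated by the usual reductions on the first-order rank, except that a cut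
-- of ∀XA against ¬∀XA derived by Ω becomes an Ω̃-inference with the premises of both sides, so
-- second-order formulas can have rank 0.  In a cut-free derivation of a Π¹-sequent no Ω occurs,
-- since its principal formula ∃X¬A is not Π¹, and every Ω̃ disappears: its 0-premise, collapsed
-- for a fresh Y, is a cut-free BI^Ω_0-derivation of Γ, A(Y), hence an index of the Ω̃-inference
-- whose premise derives Γ.

module Submission where

open import Defs
open import Data.Nat using (ℕ; suc; _≤_; s≤s; _⊔_; _≟_)
open import Data.Nat.Properties using (m≤m⊔n; m≤n⊔m; ≤-trans; ≤-refl; <-irrefl)
open import Data.Fin using (Fin)
open import Data.Bool using (Bool; true; false; T)
open import Data.Unit using (tt)
open import Data.Empty using (⊥-elim)
open import Data.Product using (Σ; _×_; _,_)
open import Data.Sum using (_⊎_; inj₁; inj₂; [_,_]; map₁; map₂; swap)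
open import Data.List using (List; []; _∷_; _++_; concatMap; map)
open import Data.List.Extrema.Nat using (max; xs≤max)
open import Data.List.Membership.Propositional using (_∈_; _∉_)
open import Data.List.Membership.Propositional.Properties
  using (∈-map⁺; ∈-map⁻; ∈-++⁺ˡ; ∈-++⁺ʳ; ∈-concatMap⁺)
open import Data.List.Relation.Unary.Any using (here; there)
import Data.List.Relation.Unary.Any as Any
open import Data.List.Relation.Unary.All using (_∷_; lookup; tabulate)
import Data.List.Relation.Unary.All as All
open import Data.List.Relation.Unary.All.Properties using (map⁺)
open import Function using (_∘_; id; _↔_; Inverse; Injection; mk↔ₛ′)
open import Function.Definitions using (Injective)
open import Function.Properties.Inverse using (↔-refl; ↔-sym; ↔-trans; ↔⇒↣)
open import Level using (0ℓ)
open import Relation.Binary.PropositionalEquality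
  using (_≡_; _≢_; refl; sym; trans; cong; cong₂; subst)
open import Relation.Nullary using (¬_; yes; no)
open import Relation.Unary using (Pred; _⊆_; _∪_; ｛_｝)

open Inverse using (to; from; strictlyInverseˡ)

negB-involutive : ∀ {n} (A : Body n) → negB (negB A) ≡ A
negB-involutive (rel f ts)  = refl
negB-involutive (nrel f ts) = refl
negB-involutive (memX t)    = refl
negB-involutive (nmemX t)   = refl
negB-involutive (A ⋀ B)     = cong₂ _⋀_ (negB-involutive A) (negB-involutive B)
negB-involutive (A ⋁ B)     = cong₂ _⋁_ (negB-involutive A) (negB-involutive B)
negB-involutive (all A)     = cong all (negB-involutive A)
negB-involutive (ex A)      = cong ex (negB-involutive A)

neg-involutive : ∀ {n} (A : Fm n) → neg (neg A) ≡ A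
neg-involutive (rel f ts)  = refl
neg-involutive (nrel f ts) = refl
neg-involutive (mem X t)   = refl
neg-involutive (nmem X t)  = refl
neg-involutive (A ⋀ B)     = cong₂ _⋀_ (neg-involutive A) (neg-involutive B)
neg-involutive (A ⋁ B)     = cong₂ _⋁_ (neg-involutive A) (neg-involutive B)
neg-involutive (all A)     = cong all (neg-involutive A)
neg-involutive (ex A)      = cong ex (neg-involutive A)
neg-involutive (all2 A)    = cong all2 (negB-involutive A)
neg-involutive (ex2 A)     = cong ex2 (negB-involutive A)

neg-injective : ∀ {n} {A B : Fm n} → neg A ≡ neg B → A ≡ B
neg-injective {A = A} {B} e =
  trans (sym (neg-involutive A)) (trans (cong neg e) (neg-involutive B))

neg≢self : ∀ {n} (A : Fm n) → neg A ≢ A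
neg≢self (rel f ts)  ()
neg≢self (nrel f ts) ()
neg≢self (mem X t)   ()
neg≢self (nmem X t)  ()
neg≢self (A ⋀ B)     ()
neg≢self (A ⋁ B)     ()
neg≢self (all A)     ()
neg≢self (ex A)      ()
neg≢self (all2 A)    ()
neg≢self (ex2 A)     ()

negB-subB : ∀ {n m} (σ : Fin n → Tm m) (A : Body n) → negB (subB σ A) ≡ subB σ (negB A)
negB-subB σ (rel f ts)  = refl
negB-subB σ (nrel f ts) = refl
negB-subB σ (memX t)    = refl
negB-subB σ (nmemX t)   = refl
negB-subB σ (A ⋀ B)     = cong₂ _⋁_ (negB-subB σ A) (negB-subB σ B)
negB-subB σ (A ⋁ B)     = cong₂ _⋀_ (negB-subB σ A) (negB-subB σ B)
negB-subB σ (all A)     = cong ex (negB-subB (lift σ) A)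
negB-subB σ (ex A)      = cong all (negB-subB (lift σ) A)

neg-subF : ∀ {n m} (σ : Fin n → Tm m) (A : Fm n) → neg (subF σ A) ≡ subF σ (neg A)
neg-subF σ (rel f ts)  = refl
neg-subF σ (nrel f ts) = refl
neg-subF σ (mem X t)   = refl
neg-subF σ (nmem X t)  = refl
neg-subF σ (A ⋀ B)     = cong₂ _⋁_ (neg-subF σ A) (neg-subF σ B)
neg-subF σ (A ⋁ B)     = cong₂ _⋀_ (neg-subF σ A) (neg-subF σ B)
neg-subF σ (all A)     = cong ex (neg-subF (lift σ) A)
neg-subF σ (ex A)      = cong all (neg-subF (lift σ) A)
neg-subF σ (all2 A)    = cong ex2 (negB-subB σ A)
neg-subF σ (ex2 A)     = cong all2 (negB-subB σ A)

neg-[] : (A : Fm 1) (k : ℕ) → neg (A [ k ]) ≡ neg A [ k ]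
neg-[] A k = neg-subF _ A

neg-pick : ∀ k (A B : Fm 0) → neg (pick k A B) ≡ pick k (neg A) (neg B)
neg-pick false A B = refl
neg-pick true  A B = refl

rank : ∀ {n} → Fm n → ℕ
rank (A ⋀ B) = suc (rank A ⊔ rank B)
rank (A ⋁ B) = suc (rank A ⊔ rank B)
rank (all A) = suc (rank A)
rank (ex A)  = suc (rank A)
rank _       = 0

rank-subF : ∀ {n m} (σ : Fin n → Tm m) (A : Fm n) → rank (subF σ A) ≡ rank A
rank-subF σ (rel f ts)  = refl
rank-subF σ (nrel f ts) = refl
rank-subF σ (mem X t)   = refl
rank-subF σ (nmem X t)  = refl
rank-subF σ (A ⋀ B)     = cong₂ (λ a b → suc (a ⊔ b)) (rank-subF σ A) (rank-subF σ B)
rank-subF σ (A ⋁ B)     = cong₂ (λ a b → suc (a ⊔ b)) (rank-subF σ A) (rank-subF σ B)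
rank-subF σ (all A)     = cong suc (rank-subF (lift σ) A)
rank-subF σ (ex A)      = cong suc (rank-subF (lift σ) A)
rank-subF σ (all2 A)    = refl
rank-subF σ (ex2 A)     = refl

rank-[]-≤ : ∀ (A : Fm 1) k {m} → rank A ≤ m → rank (A [ k ]) ≤ m
rank-[]-≤ A k = subst (_≤ _) (sym (rank-subF _ A))

rank-pick-≤ : ∀ k (A B : Fm 0) {m} → rank A ⊔ rank B ≤ m → rank (pick k A B) ≤ m
rank-pick-≤ false A B = ≤-trans (m≤m⊔n (rank A) (rank B))
rank-pick-≤ true  A B = ≤-trans (m≤n⊔m (rank A) (rank B))

Pi1-subF : ∀ {n m} (σ : Fin n → Tm m) (A : Fm n) → Pi1 A → Pi1 (subF σ A)
Pi1-subF σ (rel f ts)  _       = tt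
Pi1-subF σ (nrel f ts) _       = tt
Pi1-subF σ (mem X t)   _       = tt
Pi1-subF σ (nmem X t)  _       = tt
Pi1-subF σ (A ⋀ B)     (p , q) = Pi1-subF σ A p , Pi1-subF σ B q
Pi1-subF σ (A ⋁ B)     (p , q) = Pi1-subF σ A p , Pi1-subF σ B q
Pi1-subF σ (all A)     p       = Pi1-subF (lift σ) A p
Pi1-subF σ (ex A)      p       = Pi1-subF (lift σ) A p
Pi1-subF σ (all2 A)    _       = tt

Pi1-inst : ∀ {n} Y (A : Body n) → Pi1 (inst Y A)
Pi1-inst Y (rel f ts)  = tt
Pi1-inst Y (nrel f ts) = tt
Pi1-inst Y (memX t)    = tt
Pi1-inst Y (nmemX t)   = tt
Pi1-inst Y (A ⋀ B)     = Pi1-inst Y A , Pi1-inst Y B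
Pi1-inst Y (A ⋁ B)     = Pi1-inst Y A , Pi1-inst Y B
Pi1-inst Y (all A)     = Pi1-inst Y A
Pi1-inst Y (ex A)      = Pi1-inst Y A

Pi1-pick : ∀ k {A B : Fm 0} → Pi1 A × Pi1 B → Pi1 (pick k A B)
Pi1-pick false (p , q) = p
Pi1-pick true  (p , q) = q

-- Renaming set variables

rename : ∀ {n} → (SVar → SVar) → Fm n → Fm n
rename f (rel g ts)  = rel g ts
rename f (nrel g ts) = nrel g ts
rename f (mem X t)   = mem (f X) t
rename f (nmem X t)  = nmem (f X) t
rename f (A ⋀ B)     = rename f A ⋀ rename f B
rename f (A ⋁ B)     = rename f A ⋁ rename f B
rename f (all A)     = all (rename f A)
rename f (ex A)      = ex (rename f A)
rename f (all2 A)    = all2 A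
rename f (ex2 A)     = ex2 A

rename-neg : ∀ {n} f (A : Fm n) → rename f (neg A) ≡ neg (rename f A)
rename-neg f (rel g ts)  = refl
rename-neg f (nrel g ts) = refl
rename-neg f (mem X t)   = refl
rename-neg f (nmem X t)  = refl
rename-neg f (A ⋀ B)     = cong₂ _⋁_ (rename-neg f A) (rename-neg f B)
rename-neg f (A ⋁ B)     = cong₂ _⋀_ (rename-neg f A) (rename-neg f B)
rename-neg f (all A)     = cong ex (rename-neg f A)
rename-neg f (ex A)      = cong all (rename-neg f A)
rename-neg f (all2 A)    = refl
rename-neg f (ex2 A)     = refl

rename-subF : ∀ {n m} f (σ : Fin n → Tm m) (A : Fm n) → rename f (subF σ A) ≡ subF σ (rename f A)
rename-subF f σ (rel g ts)  = refl
rename-subF f σ (nrel g ts) = refl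
rename-subF f σ (mem X t)   = refl
rename-subF f σ (nmem X t)  = refl
rename-subF f σ (A ⋀ B)     = cong₂ _⋀_ (rename-subF f σ A) (rename-subF f σ B)
rename-subF f σ (A ⋁ B)     = cong₂ _⋁_ (rename-subF f σ A) (rename-subF f σ B)
rename-subF f σ (all A)     = cong all (rename-subF f (lift σ) A)
rename-subF f σ (ex A)      = cong ex (rename-subF f (lift σ) A)
rename-subF f σ (all2 A)    = refl
rename-subF f σ (ex2 A)     = refl

rename-[] : ∀ f (A : Fm 1) k → rename f (A [ k ]) ≡ rename f A [ k ]
rename-[] f A k = rename-subF f _ A

rename-inst : ∀ {n} f Y (A : Body n) → rename f (inst Y A) ≡ inst (f Y) A
rename-inst f Y (rel g ts)  = refl
rename-inst f Y (nrel g ts) = refl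
rename-inst f Y (memX t)    = refl
rename-inst f Y (nmemX t)   = refl
rename-inst f Y (A ⋀ B)     = cong₂ _⋀_ (rename-inst f Y A) (rename-inst f Y B)
rename-inst f Y (A ⋁ B)     = cong₂ _⋁_ (rename-inst f Y A) (rename-inst f Y B)
rename-inst f Y (all A)     = cong all (rename-inst f Y A)
rename-inst f Y (ex A)      = cong ex (rename-inst f Y A)

rename-pick : ∀ f k (A B : Fm 0) → rename f (pick k A B) ≡ pick k (rename f A) (rename f B)
rename-pick f false A B = refl
rename-pick f true  A B = refl

rename-∘ : ∀ {n} f g (A : Fm n) → rename f (rename g A) ≡ rename (f ∘ g) A
rename-∘ f g (rel h ts)  = refl
rename-∘ f g (nrel h ts) = refl
rename-∘ f g (mem X t)   = refl
rename-∘ f g (nmem X t)  = refl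
rename-∘ f g (A ⋀ B)     = cong₂ _⋀_ (rename-∘ f g A) (rename-∘ f g B)
rename-∘ f g (A ⋁ B)     = cong₂ _⋁_ (rename-∘ f g A) (rename-∘ f g B)
rename-∘ f g (all A)     = cong all (rename-∘ f g A)
rename-∘ f g (ex A)      = cong ex (rename-∘ f g A)
rename-∘ f g (all2 A)    = refl
rename-∘ f g (ex2 A)     = refl

rename-fixing-fv : ∀ {n} f (A : Fm n) → (∀ Z → Z ∈fv A → f Z ≡ Z) → rename f A ≡ A
rename-fixing-fv f (rel g ts)  h = refl
rename-fixing-fv f (nrel g ts) h = refl
rename-fixing-fv f (mem X t)   h = cong (λ Z → mem Z t) (h X refl)
rename-fixing-fv f (nmem X t)  h = cong (λ Z → nmem Z t) (h X refl)
rename-fixing-fv f (A ⋀ B)     h =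
  cong₂ _⋀_ (rename-fixing-fv f A (λ Z → h Z ∘ inj₁)) (rename-fixing-fv f B (λ Z → h Z ∘ inj₂))
rename-fixing-fv f (A ⋁ B)     h =
  cong₂ _⋁_ (rename-fixing-fv f A (λ Z → h Z ∘ inj₁)) (rename-fixing-fv f B (λ Z → h Z ∘ inj₂))
rename-fixing-fv f (all A)     h = cong all (rename-fixing-fv f A h)
rename-fixing-fv f (ex A)      h = cong ex (rename-fixing-fv f A h)
rename-fixing-fv f (all2 A)    h = refl
rename-fixing-fv f (ex2 A)     h = refl

rename-id : ∀ {n} (A : Fm n) → rename id A ≡ A
rename-id A = rename-fixing-fv id A (λ _ _ → refl)

∉fv-rename : ∀ {f} → Injective _≡_ _≡_ f → ∀ {n Z} (A : Fm n) → ¬ Z ∈fv A → ¬ f Z ∈fv rename f A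
∉fv-rename inj (mem X t)  Z∉ = Z∉ ∘ inj
∉fv-rename inj (nmem X t) Z∉ = Z∉ ∘ inj
∉fv-rename inj (A ⋀ B)    Z∉ = [ ∉fv-rename inj A (Z∉ ∘ inj₁) , ∉fv-rename inj B (Z∉ ∘ inj₂) ]
∉fv-rename inj (A ⋁ B)    Z∉ = [ ∉fv-rename inj A (Z∉ ∘ inj₁) , ∉fv-rename inj B (Z∉ ∘ inj₂) ]
∉fv-rename inj (all A)    Z∉ = ∉fv-rename inj A Z∉
∉fv-rename inj (ex A)     Z∉ = ∉fv-rename inj A Z∉

Pi1-rename : ∀ {n} f (A : Fm n) → Pi1 A → Pi1 (rename f A)
Pi1-rename f (rel g ts)  _       = tt
Pi1-rename f (nrel g ts) _       = tt
Pi1-rename f (mem X t)   _       = tt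
Pi1-rename f (nmem X t)  _       = tt
Pi1-rename f (A ⋀ B)     (p , q) = Pi1-rename f A p , Pi1-rename f B q
Pi1-rename f (A ⋁ B)     (p , q) = Pi1-rename f A p , Pi1-rename f B q
Pi1-rename f (all A)     p       = Pi1-rename f A p
Pi1-rename f (ex A)      p       = Pi1-rename f A p
Pi1-rename f (all2 A)    _       = tt

TRUE-rename : ∀ f (A : Fm 0) → TRUE A → TRUE (rename f A)
TRUE-rename f (rel g ts)  t = t
TRUE-rename f (nrel g ts) t = t

fvs : ∀ {n} → Fm n → List SVar
fvs (mem X t)  = X ∷ []
fvs (nmem X t) = X ∷ []
fvs (A ⋀ B)    = fvs A ++ fvs B
fvs (A ⋁ B)    = fvs A ++ fvs B
fvs (all A)    = fvs A
fvs (ex A)     = fvs A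
fvs _          = []

∈fv⇒∈fvs : ∀ {n Z} (A : Fm n) → Z ∈fv A → Z ∈ fvs A
∈fv⇒∈fvs (mem X t)  e        = here e
∈fv⇒∈fvs (nmem X t) e        = here e
∈fv⇒∈fvs (A ⋀ B)    (inj₁ z) = ∈-++⁺ˡ (∈fv⇒∈fvs A z)
∈fv⇒∈fvs (A ⋀ B)    (inj₂ z) = ∈-++⁺ʳ (fvs A) (∈fv⇒∈fvs B z)
∈fv⇒∈fvs (A ⋁ B)    (inj₁ z) = ∈-++⁺ˡ (∈fv⇒∈fvs A z)
∈fv⇒∈fvs (A ⋁ B)    (inj₂ z) = ∈-++⁺ʳ (fvs A) (∈fv⇒∈fvs B z)
∈fv⇒∈fvs (all A)    z        = ∈fv⇒∈fvs A z
∈fv⇒∈fvs (ex A)     z        = ∈fv⇒∈fvs A z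

fvsSeq : Seq → List SVar
fvsSeq = concatMap fvs

∈fv⇒∈fvsSeq : ∀ {Γ B Z} → B ∈ Γ → Z ∈fv B → Z ∈ fvsSeq Γ
∈fv⇒∈fvsSeq {B = B} B∈Γ z = ∈-concatMap⁺ fvs (Any.map (λ { refl → ∈fv⇒∈fvs B z }) B∈Γ)

fresh : List SVar → SVar
fresh xs = suc (max 0 xs)

fresh∉ : ∀ xs → fresh xs ∉ xs
fresh∉ xs m = <-irrefl refl (lookup (xs≤max 0 xs) m)

transpose : SVar → SVar → SVar → SVar
transpose a b z with z ≟ a
... | yes _ = b
... | no _ with z ≟ b
...   | yes _ = a
...   | no _  = z

transpose-a : ∀ a b → transpose a b a ≡ b
transpose-a a b with a ≟ a
... | yes _  = refl
... | no a≢a = ⊥-elim (a≢a refl)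

transpose-b : ∀ a b → transpose a b b ≡ a
transpose-b a b with b ≟ a
... | yes b≡a = b≡a
... | no _ with b ≟ b
...   | yes _  = refl
...   | no b≢b = ⊥-elim (b≢b refl)

transpose-other : ∀ {a b z} → z ≢ a → z ≢ b → transpose a b z ≡ z
transpose-other {a} {b} {z} z≢a z≢b with z ≟ a
... | yes z≡a = ⊥-elim (z≢a z≡a)
... | no _ with z ≟ b
...   | yes z≡b = ⊥-elim (z≢b z≡b)
...   | no _    = refl

transpose-involutive : ∀ a b z → transpose a b (transpose a b z) ≡ z
transpose-involutive a b z with z ≟ a
... | yes refl = transpose-b z b
... | no z≢a with z ≟ b
...   | yes refl = transpose-a a z
...   | no z≢b   = transpose-other z≢a z≢b

transposition : SVar → SVar → SVar ↔ SVar
transposition a b =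
  mk↔ₛ′ (transpose a b) (transpose a b) (transpose-involutive a b) (transpose-involutive a b)

to-injective : (σ : SVar ↔ SVar) → Injective _≡_ _≡_ (to σ)
to-injective σ = Injection.injective (↔⇒↣ σ)

rename-to-from : (σ : SVar ↔ SVar) (B : Fm 0) → rename (to σ) (rename (from σ) B) ≡ B
rename-to-from σ B =
  trans (rename-∘ (to σ) (from σ) B) (rename-fixing-fv _ B (λ Z _ → strictlyInverseˡ σ Z))

module _ {f : SVar → SVar} (f-inj : Injective _≡_ _≡_ f) where

  rename-premise : ∀ {Γ Γᵢ : Seq} {M M′ : Fm 0 → Set}
                 → (∀ {B} → B ∈ Γᵢ → B ∈ Γ ⊎ M B) → (∀ {B} → M B → M′ (rename f B))
                 → ∀ {B} → B ∈ map (rename f) Γᵢ → B ∈ map (rename f) Γ ⊎ M′ B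
  rename-premise premise minor B∈ with ∈-map⁻ (rename f) B∈
  ... | _ , B∈Γᵢ , refl with premise B∈Γᵢ
  ...   | inj₁ B∈Γ = inj₁ (∈-map⁺ (rename f) B∈Γ)
  ...   | inj₂ M   = inj₂ (minor M)

  renameDer : ∀ {Γ} → Der BI0cf Γ → Der BI0cf (map (rename f) Γ)
  renameDer (node (axT A t) pr _ _ _ _) =
    node (axT (rename f A) (TRUE-rename f A t)) (λ { refl → ∈-map⁺ _ (pr refl) }) tt
         (λ ()) (λ ()) (λ ())
  renameDer (node (axC C) pr _ _ _ _) =
    node (axC (rename f C))
         (λ { (inj₁ refl) → ∈-map⁺ _ (pr (inj₁ refl))
            ; (inj₂ refl) → subst (_∈ _) (rename-neg f C) (∈-map⁺ _ (pr (inj₂ refl))) })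
         tt (λ ()) (λ ()) (λ ())
  renameDer (node (andI A₀ A₁) pr _ Γs ds mins) =
    node (andI (rename f A₀) (rename f A₁)) (λ { refl → ∈-map⁺ _ (pr refl) }) tt
         (map (rename f) ∘ Γs) (renameDer ∘ ds)
         (λ k → rename-premise (mins k) (λ { refl → rename-pick f k A₀ A₁ }))
  renameDer (node (orI k A₀ A₁) pr _ Γs ds mins) =
    node (orI k (rename f A₀) (rename f A₁)) (λ { refl → ∈-map⁺ _ (pr refl) }) tt
         (map (rename f) ∘ Γs) (renameDer ∘ ds)
         (λ i → rename-premise (mins i) (λ { refl → rename-pick f k A₀ A₁ }))
  renameDer (node (allI A) pr _ Γs ds mins) =
    node (allI (rename f A)) (λ { refl → ∈-map⁺ _ (pr refl) }) tt
         (map (rename f) ∘ Γs) (renameDer ∘ ds)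
         (λ n → rename-premise (mins n) (λ { refl → rename-[] f A n }))
  renameDer (node (exI k A) pr _ Γs ds mins) =
    node (exI k (rename f A)) (λ { refl → ∈-map⁺ _ (pr refl) }) tt
         (map (rename f) ∘ Γs) (renameDer ∘ ds)
         (λ i → rename-premise (mins i) (λ { refl → rename-[] f A k }))
  renameDer (node (all2I A Y) pr Y∉Γ Γs ds mins) =
    node (all2I A (f Y)) (λ { refl → ∈-map⁺ _ (pr refl) })
         (map⁺ (All.map (λ {B} → ∉fv-rename f-inj B) Y∉Γ))
         (map (rename f) ∘ Γs) (renameDer ∘ ds)
         (λ i → rename-premise (mins i) (λ { refl → rename-inst f Y A }))
  renameDer (node rep _ _ Γs ds mins) =
    node rep (λ ()) tt (map (rename f) ∘ Γs) (renameDer ∘ ds)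
         (λ i → rename-premise (mins i) (λ ()))

  renameIdx : ∀ {A} → OmIdx A → OmIdx A
  renameIdx {A} q = record
    { Γe   = map (rename f) (Γe q)
    ; e    = renameDer (e q)
    ; pi1  = map⁺ (All.map (λ {B} → Pi1-rename f B) (pi1 q))
    ; Z    = f (Z q)
    ; free = Z-fresh }
    where
    Z-fresh : ∀ B → B ∈ map (rename f) (Γe q) → B ≢ inst (f (Z q)) A → ¬ f (Z q) ∈fv B
    Z-fresh _ B∈ B≢ with ∈-map⁻ (rename f) B∈
    ... | B₀ , B₀∈ , refl = ∉fv-rename f-inj B₀ (free q B₀ B₀∈ (B≢ ∘ renamed-≡))
      where
      renamed-≡ : B₀ ≡ inst (Z q) A → rename f B₀ ≡ inst (f (Z q)) A
      renamed-≡ e = trans (cong (rename f) e) (rename-inst f (Z q) A)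

renameIdx⁻ : (σ : SVar ↔ SVar) {A : Body 0} → OmIdx A → OmIdx A
renameIdx⁻ σ = renameIdx (to-injective (↔-sym σ))

Δq-renameIdx⁻ : (σ : SVar ↔ SVar) {A : Body 0} (q : OmIdx A) {B : Fm 0}
              → Δq A (renameIdx⁻ σ q) B → Δq A q (rename (to σ) B)
Δq-renameIdx⁻ σ {A} q (B∈ , B≢) with ∈-map⁻ (rename (from σ)) B∈
... | B₀ , B₀∈ , refl = subst (_∈ Γe q) (sym B₀-back) B₀∈ , B₀≢
  where
  B₀-back : rename (to σ) (rename (from σ) B₀) ≡ B₀
  B₀-back = rename-to-from σ B₀
  B₀≢ : rename (to σ) (rename (from σ) B₀) ≢ inst (Z q) A
  B₀≢ e = B≢ (trans (cong (rename (from σ)) (trans (sym B₀-back) e)) (rename-inst (from σ) (Z q) A))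

-- The auxiliary calculus

PSeq : Set₁
PSeq = Pred (Fm 0) 0ℓ

-- A sequent may be infinite, so eigenvariables are only required to avoid a finite list L.
data Deriv (c : Bool) : PSeq → Set₁ where
  axTrue  : ∀ {P} A → P A → TRUE A → Deriv c P
  axNeg   : ∀ {P} C → P C → P (neg C) → Deriv c P
  andR    : ∀ {P} A B → P (A ⋀ B) → ((k : Bool) → Deriv c (P ∪ ｛ pick k A B ｝)) → Deriv c P
  orR     : ∀ {P} A B k → P (A ⋁ B) → Deriv c (P ∪ ｛ pick k A B ｝) → Deriv c P
  allR    : ∀ {P} A → P (all A) → ((n : ℕ) → Deriv c (P ∪ ｛ A [ n ] ｝)) → Deriv c P
  exR     : ∀ {P} A n → P (ex A) → Deriv c (P ∪ ｛ A [ n ] ｝) → Deriv c P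
  all2R   : ∀ {P} A (L : List SVar) → P (all2 A)
          → ((Y : SVar) → Y ∉ L → Deriv c (P ∪ ｛ inst Y A ｝)) → Deriv c P
  cutR    : ∀ {P} → T c → (C : Fm 0) → Deriv c (P ∪ ｛ C ｝) → Deriv c (P ∪ ｛ neg C ｝) → Deriv c P
  omegaR  : ∀ {P} A → P (neg (all2 A)) → ((q : OmIdx A) → Deriv c (P ∪ Δq A q)) → Deriv c P
  omegaTR : ∀ {P} A (L : List SVar) → ((Y : SVar) → Y ∉ L → Deriv c (P ∪ ｛ inst Y A ｝))
          → ((q : OmIdx A) → Deriv c (P ∪ Δq A q)) → Deriv c P

weaken : ∀ {c P Q} → P ⊆ Q → Deriv c P → Deriv c Q
weaken s (axTrue A p t)    = axTrue A (s p) t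
weaken s (axNeg C p p′)    = axNeg C (s p) (s p′)
weaken s (andR A B p d)    = andR A B (s p) (λ k → weaken (map₁ s) (d k))
weaken s (orR A B k p d)   = orR A B k (s p) (weaken (map₁ s) d)
weaken s (allR A p d)      = allR A (s p) (λ n → weaken (map₁ s) (d n))
weaken s (exR A n p d)     = exR A n (s p) (weaken (map₁ s) d)
weaken s (all2R A L p d)   = all2R A L (s p) (λ Y Y∉ → weaken (map₁ s) (d Y Y∉))
weaken s (cutR c C d d′)   = cutR c C (weaken (map₁ s) d) (weaken (map₁ s) d′)
weaken s (omegaR A p d)    = omegaR A (s p) (λ q → weaken (map₁ s) (d q))
weaken s (omegaTR A L d d′) =
  omegaTR A L (λ Y Y∉ → weaken (map₁ s) (d Y Y∉)) (λ q → weaken (map₁ s) (d′ q))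

record _⟨_⟩⊆_ (Γ : Seq) (f : SVar → SVar) (P : PSeq) : Set where
  constructor mk⟨⟩⊆
  field renamed-∈ : ∀ {B} → B ∈ Γ → P (rename f B)
open _⟨_⟩⊆_

premise-⊆ : ∀ {f P R Γ Γᵢ} {M : Fm 0 → Set} → Γ ⟨ f ⟩⊆ P
          → (∀ {B} → B ∈ Γᵢ → B ∈ Γ ⊎ M B) → (∀ {B} → M B → R (rename f B))
          → Γᵢ ⟨ f ⟩⊆ (P ∪ R)
premise-⊆ Γ⊆ premise minor = mk⟨⟩⊆ (map₁ (renamed-∈ Γ⊆) ∘ map₂ minor ∘ premise)

rename-transpose-∉fv : ∀ {a b} (B : Fm 0) → ¬ a ∈fv B → ¬ b ∈fv B → rename (transpose a b) B ≡ B
rename-transpose-∉fv B a∉ b∉ =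
  rename-fixing-fv _ B (λ Z Z∈ → transpose-other (λ { refl → a∉ Z∈ }) (λ { refl → b∉ Z∈ }))

retarget : (σ : SVar ↔ SVar) → SVar → SVar → SVar ↔ SVar
retarget σ Y Y′ = ↔-trans σ (transposition (to σ Y) Y′)

-- The transposition fixes σ Γ: Y′ is fresh for it and σ Y is not free in it.
eigenvariable-⊆ : ∀ {P Γ Γᵢ Y Y′} (σ : SVar ↔ SVar) (A : Body 0)
                → Γ ⟨ to σ ⟩⊆ P → NotFreeIn Y Γ → Y′ ∉ fvsSeq (map (rename (to σ)) Γ)
                → (∀ {B} → B ∈ Γᵢ → B ∈ Γ ⊎ B ≡ inst Y A)
                → Γᵢ ⟨ to (retarget σ Y Y′) ⟩⊆ (P ∪ ｛ inst Y′ A ｝)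
eigenvariable-⊆ {P} {Γᵢ = Γᵢ} {Y} {Y′} σ A Γ⊆ Y∉Γ Y′∉ premise = mk⟨⟩⊆ renamed
  where
  renamed : ∀ {B} → B ∈ Γᵢ → (P ∪ ｛ inst Y′ A ｝) (rename (transpose (to σ Y) Y′ ∘ to σ) B)
  renamed {B} B∈ with premise B∈
  ... | inj₁ B∈Γ = inj₁ (subst P (sym keeps-B) (renamed-∈ Γ⊆ B∈Γ))
    where
    keeps-B : rename (transpose (to σ Y) Y′ ∘ to σ) B ≡ rename (to σ) B
    keeps-B = trans (sym (rename-∘ _ (to σ) B))
                    (rename-transpose-∉fv (rename (to σ) B)
                       (∉fv-rename (to-injective σ) B (lookup Y∉Γ B∈Γ))
                       (Y′∉ ∘ ∈fv⇒∈fvsSeq (∈-map⁺ _ B∈Γ)))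
  ... | inj₂ refl =
    inj₂ (sym (trans (rename-inst _ Y A) (cong (λ Z → inst Z A) (transpose-a (to σ Y) Y′))))

embed : ∀ {Γ P} (σ : SVar ↔ SVar) → Der BIΩ Γ → Γ ⟨ to σ ⟩⊆ P → Deriv true P
embed σ (node (base (axT A t)) pr _ _ _ _) Γ⊆ =
  axTrue _ (renamed-∈ Γ⊆ (pr refl)) (TRUE-rename _ A t)
embed {P = P} σ (node (base (axC C)) pr _ _ _ _) Γ⊆ =
  axNeg _ (renamed-∈ Γ⊆ (pr (inj₁ refl))) (subst P (rename-neg _ C) (renamed-∈ Γ⊆ (pr (inj₂ refl))))
embed σ (node (base (andI A₀ A₁)) pr _ _ ds mins) Γ⊆ =
  andR _ _ (renamed-∈ Γ⊆ (pr refl)) λ k →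
    embed σ (ds k) (premise-⊆ Γ⊆ (mins k) λ { refl → sym (rename-pick _ k A₀ A₁) })
embed σ (node (base (orI k A₀ A₁)) pr _ _ ds mins) Γ⊆ =
  orR _ _ k (renamed-∈ Γ⊆ (pr refl))
    (embed σ (ds tt) (premise-⊆ Γ⊆ (mins tt) λ { refl → sym (rename-pick _ k A₀ A₁) }))
embed σ (node (base (allI A)) pr _ _ ds mins) Γ⊆ =
  allR _ (renamed-∈ Γ⊆ (pr refl)) λ n →
    embed σ (ds n) (premise-⊆ Γ⊆ (mins n) λ { refl → sym (rename-[] _ A n) })
embed σ (node (base (exI n A)) pr _ _ ds mins) Γ⊆ =
  exR _ n (renamed-∈ Γ⊆ (pr refl))
    (embed σ (ds tt) (premise-⊆ Γ⊆ (mins tt) λ { refl → sym (rename-[] _ A n) }))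
embed {Γ} σ (node (base (all2I A Y)) pr Y∉Γ _ ds mins) Γ⊆ =
  all2R A (fvsSeq (map (rename (to σ)) Γ)) (renamed-∈ Γ⊆ (pr refl)) λ Y′ Y′∉ →
    embed (retarget σ Y Y′) (ds tt) (eigenvariable-⊆ σ A Γ⊆ Y∉Γ Y′∉ (mins tt))
embed σ (node (base (cutI _ C)) _ _ _ ds mins) Γ⊆ =
  cutR tt _ (embed σ (ds true) (premise-⊆ Γ⊆ (mins true) λ { refl → refl }))
            (embed σ (ds false) (premise-⊆ Γ⊆ (mins false) λ { refl → sym (rename-neg _ C) }))
embed σ (node (base rep) _ _ _ ds mins) Γ⊆ =
  embed σ (ds tt) (mk⟨⟩⊆ ([ renamed-∈ Γ⊆ , (λ ()) ] ∘ mins tt))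
embed σ (node (omega A) pr _ _ ds mins) Γ⊆ =
  omegaR A (renamed-∈ Γ⊆ (pr refl)) λ q →
    embed σ (ds (renameIdx⁻ σ q)) (premise-⊆ Γ⊆ (mins _) (Δq-renameIdx⁻ σ q))
embed {Γ} σ (node (omegaT A Y) _ Y∉Γ _ ds mins) Γ⊆ =
  omegaTR A (fvsSeq (map (rename (to σ)) Γ))
    (λ Y′ Y′∉ → embed (retarget σ Y Y′) (ds (inj₁ tt))
                      (eigenvariable-⊆ σ A Γ⊆ Y∉Γ Y′∉ (mins (inj₁ tt))))
    (λ q → embed σ (ds (inj₂ (renameIdx⁻ σ q)))
                   (premise-⊆ Γ⊆ (mins _) (Δq-renameIdx⁻ σ q)))

-- Cut elimination

Ω-Premises : PSeq → Body 0 → Set₁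
Ω-Premises Q A = (q : OmIdx A) → Deriv false (Q ∪ Δq A q)

∀X-Premises : PSeq → Body 0 → Set₁
∀X-Premises Q A = Σ (List SVar) λ L → (Y : SVar) → Y ∉ L → Deriv false (Q ∪ ｛ inst Y A ｝)

omegaT-rule : ∀ {Q} A → ∀X-Premises Q A → Ω-Premises Q A → Deriv false Q
omegaT-rule A (L , d) = omegaTR A L d

-- Cut-free premises of an inference with conclusion Q and principal formula C; for a literal
-- the inference is an axiom, so C is true.  Up to negB-involutive, ex2 A is ¬∀X(negB A),
-- principal only in Ω.
Inversion : PSeq → Fm 0 → Set₁
Inversion Q (A ⋀ B)  = (k : Bool) → Deriv false (Q ∪ ｛ pick k A B ｝)
Inversion Q (A ⋁ B)  = Σ Bool λ k → Deriv false (Q ∪ ｛ pick k A B ｝)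
Inversion Q (all A)  = (n : ℕ) → Deriv false (Q ∪ ｛ A [ n ] ｝)
Inversion Q (ex A)   = Σ ℕ λ n → Deriv false (Q ∪ ｛ A [ n ] ｝)
Inversion Q (all2 A) = ∀X-Premises Q A
Inversion Q (ex2 A)  = Ω-Premises Q (negB A)
Inversion Q A        = Level.Lift _ (TRUE A)

Inversion-mono : ∀ {Q Q′} C → Q ⊆ Q′ → Inversion Q C → Inversion Q′ C
Inversion-mono (rel f ts)  s inv      = inv
Inversion-mono (nrel f ts) s inv      = inv
Inversion-mono (mem X t)   s inv      = inv
Inversion-mono (nmem X t)  s inv      = inv
Inversion-mono (A ⋀ B)     s inv      = λ k → weaken (map₁ s) (inv k)
Inversion-mono (A ⋁ B)     s (k , d)  = k , weaken (map₁ s) d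
Inversion-mono (all A)     s inv      = λ n → weaken (map₁ s) (inv n)
Inversion-mono (ex A)      s (n , d)  = n , weaken (map₁ s) d
Inversion-mono (all2 A)    s (L , d)  = L , λ Y Y∉ → weaken (map₁ s) (d Y Y∉)
Inversion-mono (ex2 A)     s inv      = λ q → weaken (map₁ s) (inv q)

TRUE⇒Inversion : ∀ {Q} A → TRUE A → Inversion Q A
TRUE⇒Inversion (rel f ts)  t = Level.lift t
TRUE⇒Inversion (nrel f ts) t = Level.lift t

TRUE⇒¬Inversion-neg : ∀ {Q} A → TRUE A → ¬ Inversion Q (neg A)
TRUE⇒¬Inversion-neg (rel f ts)  t inv = t (Level.lower inv)
TRUE⇒¬Inversion-neg (nrel f ts) t inv = Level.lower inv t

∪-push : ∀ {P Q R : PSeq} {C} → P ⊆ Q ∪ ｛ C ｝ → P ∪ R ⊆ (Q ∪ R) ∪ ｛ C ｝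
∪-push h = [ map₁ inj₁ ∘ h , inj₁ ∘ inj₂ ]

∪-absorb : ∀ {Q : PSeq} {C} → Q C → Q ∪ ｛ C ｝ ⊆ Q
∪-absorb c = [ id , (λ { refl → c }) ]

-- A cut on N is reduced by recursion on the derivation of ¬N until ¬N is principal, then on
-- the derivation of N; the lexicographic measure is (rank bound, left derivation, right one).
mutual
  cut-elim : ∀ n {N P₀ P₁ Q} → rank N ≤ n → Deriv false P₀ → Deriv false P₁
           → P₀ ⊆ Q ∪ ｛ neg N ｝ → P₁ ⊆ Q ∪ ｛ N ｝ → Deriv false Q
  cut-elim n r d@(axTrue A p t) d₁ h₀ h₁ =
    side-or-principal n r (h₀ p) (λ q _ → axTrue A q t) (TRUE⇒Inversion A t) (weaken h₀ d) d₁ h₁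
  cut-elim n {N} {Q = Q} r (axNeg C p p′) d₁ h₀ h₁ with h₀ p | h₀ p′
  ... | inj₁ c | inj₁ c′ = axNeg C c c′
  ... | inj₁ c | inj₂ e  = weaken (∪-absorb (subst Q (sym (neg-injective e)) c) ∘ h₁) d₁
  ... | inj₂ e | inj₁ c′ =
    weaken (∪-absorb (subst Q (trans (cong neg (sym e)) (neg-involutive N)) c′) ∘ h₁) d₁
  ... | inj₂ e | inj₂ e′ = ⊥-elim (neg≢self C (trans (sym e′) e))
  cut-elim n r d@(andR A B p e) d₁ h₀ h₁ =
    side-or-principal n r (h₀ p) (andR A B)
      (λ k → cut-elim-under n r (e k) d₁ h₀ h₁) (weaken h₀ d) d₁ h₁
  cut-elim n r d@(orR A B k p e) d₁ h₀ h₁ =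
    side-or-principal n r (h₀ p) (λ q (k , e′) → orR A B k q e′)
      (k , cut-elim-under n r e d₁ h₀ h₁) (weaken h₀ d) d₁ h₁
  cut-elim n r d@(allR A p e) d₁ h₀ h₁ =
    side-or-principal n r (h₀ p) (allR A)
      (λ m → cut-elim-under n r (e m) d₁ h₀ h₁) (weaken h₀ d) d₁ h₁
  cut-elim n r d@(exR A m p e) d₁ h₀ h₁ =
    side-or-principal n r (h₀ p) (λ q (m , e′) → exR A m q e′)
      (m , cut-elim-under n r e d₁ h₀ h₁) (weaken h₀ d) d₁ h₁
  cut-elim n r d@(all2R A L p e) d₁ h₀ h₁ =
    side-or-principal n r (h₀ p) (λ q (L , e′) → all2R A L q e′)
      (L , λ Y Y∉ → cut-elim-under n r (e Y Y∉) d₁ h₀ h₁) (weaken h₀ d) d₁ h₁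
  cut-elim n {Q = Q} r d@(omegaR A p e) d₁ h₀ h₁ =
    side-or-principal n r (h₀ p) (λ q _ → omegaR A q premises)
      (subst (Ω-Premises Q) (sym (negB-involutive A)) premises) (weaken h₀ d) d₁ h₁
    where
    premises : Ω-Premises Q A
    premises q = cut-elim-under n r (e q) d₁ h₀ h₁
  cut-elim n r (omegaTR A L e f) d₁ h₀ h₁ =
    omegaTR A L (λ Y Y∉ → cut-elim-under n r (e Y Y∉) d₁ h₀ h₁)
                (λ q → cut-elim-under n r (f q) d₁ h₀ h₁)

  cut-elim-under : ∀ n {N P₀ P₁ Q R} → rank N ≤ n → Deriv false (P₀ ∪ R) → Deriv false P₁
                 → P₀ ⊆ Q ∪ ｛ neg N ｝ → P₁ ⊆ Q ∪ ｛ N ｝ → Deriv false (Q ∪ R)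
  cut-elim-under n {R = R} r d₀ d₁ h₀ h₁ = cut-elim n r d₀ d₁ (∪-push {R = R} h₀) (map₁ inj₁ ∘ h₁)

  side-or-principal : ∀ n {N P₁ Q F} → rank N ≤ n → (Q ∪ ｛ neg N ｝) F
                    → (Q F → Inversion Q F → Deriv false Q) → Inversion Q F
                    → Deriv false (Q ∪ ｛ neg N ｝) → Deriv false P₁ → P₁ ⊆ Q ∪ ｛ N ｝
                    → Deriv false Q
  side-or-principal n r (inj₁ q)    rule inv left d₁ h₁ = rule q inv
  side-or-principal n r (inj₂ refl) rule inv left d₁ h₁ = cut-elim-right n r inv left d₁ h₁

  cut-elim-right : ∀ n {N P₁ Q} → rank N ≤ n → Inversion Q (neg N) → Deriv false (Q ∪ ｛ neg N ｝)
                 → Deriv false P₁ → P₁ ⊆ Q ∪ ｛ N ｝ → Deriv false Q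
  cut-elim-right n r inv left (axTrue A p t) h₁ with h₁ p
  ... | inj₁ q    = axTrue A q t
  ... | inj₂ refl = ⊥-elim (TRUE⇒¬Inversion-neg A t inv)
  cut-elim-right n {Q = Q} r inv left (axNeg C p p′) h₁ with h₁ p | h₁ p′
  ... | inj₁ c    | inj₁ c′ = axNeg C c c′
  ... | inj₁ c    | inj₂ e  =
    weaken (∪-absorb (subst Q (sym (trans (cong neg e) (neg-involutive C))) c)) left
  ... | inj₂ refl | inj₁ c′ = weaken (∪-absorb c′) left
  ... | inj₂ refl | inj₂ e  = ⊥-elim (neg≢self C (sym e))
  cut-elim-right n r inv left (andR A B p f) h₁ with h₁ p
  ... | inj₁ q = andR A B q (λ k → cut-elim-right-under n r inv left (f k) h₁)
  cut-elim-right (suc m) (s≤s r) (k , g) left (andR A B p f) h₁ | inj₂ refl =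
    cut-elim m (rank-pick-≤ k A B r) g
      (cut-elim-right-under (suc m) (s≤s r) (k , g) left (f k) h₁)
      (map₂ (trans (neg-pick k A B))) id
  cut-elim-right n r inv left (orR A B k p f) h₁ with h₁ p
  ... | inj₁ q = orR A B k q (cut-elim-right-under n r inv left f h₁)
  cut-elim-right (suc m) (s≤s r) inv left (orR A B k p f) h₁ | inj₂ refl =
    cut-elim m (rank-pick-≤ k A B r) (inv k)
      (cut-elim-right-under (suc m) (s≤s r) inv left f h₁)
      (map₂ (trans (neg-pick k A B))) id
  cut-elim-right n r inv left (allR A p f) h₁ with h₁ p
  ... | inj₁ q = allR A q (λ j → cut-elim-right-under n r inv left (f j) h₁)
  cut-elim-right (suc m) (s≤s r) (j , g) left (allR A p f) h₁ | inj₂ refl =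
    cut-elim m (rank-[]-≤ A j r) g
      (cut-elim-right-under (suc m) (s≤s r) (j , g) left (f j) h₁)
      (map₂ (trans (neg-[] A j))) id
  cut-elim-right n r inv left (exR A j p f) h₁ with h₁ p
  ... | inj₁ q = exR A j q (cut-elim-right-under n r inv left f h₁)
  cut-elim-right (suc m) (s≤s r) inv left (exR A j p f) h₁ | inj₂ refl =
    cut-elim m (rank-[]-≤ A j r) (inv j)
      (cut-elim-right-under (suc m) (s≤s r) inv left f h₁)
      (map₂ (trans (neg-[] A j))) id
  cut-elim-right n {Q = Q} r inv left (all2R A L p f) h₁ with h₁ p
  ... | inj₁ q    = all2R A L q (λ Y Y∉ → cut-elim-right-under n r inv left (f Y Y∉) h₁)
  ... | inj₂ refl =
    omegaTR A L (λ Y Y∉ → cut-elim-right-under n r inv left (f Y Y∉) h₁)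
                (subst (Ω-Premises Q) (negB-involutive A) inv)
  cut-elim-right n {Q = Q} r inv left (omegaR A p f) h₁ with h₁ p
  ... | inj₁ q    = omegaR A q (λ q′ → cut-elim-right-under n r inv left (f q′) h₁)
  ... | inj₂ refl =
    omegaT-rule A (subst (∀X-Premises Q) (negB-involutive A) inv)
                  (λ q′ → cut-elim-right-under n r inv left (f q′) h₁)
  cut-elim-right n r inv left (omegaTR A L f g) h₁ =
    omegaTR A L (λ Y Y∉ → cut-elim-right-under n r inv left (f Y Y∉) h₁)
                (λ q → cut-elim-right-under n r inv left (g q) h₁)

  cut-elim-right-under : ∀ n {N P₁ Q R} → rank N ≤ n → Inversion Q (neg N)
                       → Deriv false (Q ∪ ｛ neg N ｝) → Deriv false (P₁ ∪ R) → P₁ ⊆ Q ∪ ｛ N ｝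
                       → Deriv false (Q ∪ R)
  cut-elim-right-under n {N} {R = R} r inv left d₁ h₁ =
    cut-elim-right n r (Inversion-mono (neg N) inj₁ inv) (weaken (map₁ inj₁) left) d₁
                   (∪-push {R = R} h₁)

eliminate-cuts : ∀ {P} → Deriv true P → Deriv false P
eliminate-cuts (axTrue A p t)     = axTrue A p t
eliminate-cuts (axNeg C p p′)     = axNeg C p p′
eliminate-cuts (andR A B p d)     = andR A B p (eliminate-cuts ∘ d)
eliminate-cuts (orR A B k p d)    = orR A B k p (eliminate-cuts d)
eliminate-cuts (allR A p d)       = allR A p (eliminate-cuts ∘ d)
eliminate-cuts (exR A n p d)      = exR A n p (eliminate-cuts d)
eliminate-cuts (all2R A L p d)    = all2R A L p (λ Y Y∉ → eliminate-cuts (d Y Y∉))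
eliminate-cuts (cutR _ C d d′)    =
  cut-elim (rank C) ≤-refl (eliminate-cuts d′) (eliminate-cuts d) id id
eliminate-cuts (omegaR A p d)     = omegaR A p (eliminate-cuts ∘ d)
eliminate-cuts (omegaTR A L d d′) =
  omegaTR A L (λ Y Y∉ → eliminate-cuts (d Y Y∉)) (eliminate-cuts ∘ d′)

-- Collapsing cut-free derivations of Π¹-sequents

freshFor : List SVar → Seq → SVar
freshFor L Γ = fresh (L ++ fvsSeq Γ)

freshFor∉ : ∀ L Γ → freshFor L Γ ∉ L
freshFor∉ L Γ = fresh∉ (L ++ fvsSeq Γ) ∘ ∈-++⁺ˡ

freshFor-NotFreeIn : ∀ L Γ → NotFreeIn (freshFor L Γ) Γ
freshFor-NotFreeIn L Γ = tabulate λ B∈ → fresh∉ (L ++ fvsSeq Γ) ∘ ∈-++⁺ʳ L ∘ ∈fv⇒∈fvsSeq B∈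

∷-minor : ∀ {A : Fm 0} {Γ B} → B ∈ A ∷ Γ → B ∈ Γ ⊎ B ≡ A
∷-minor = swap ∘ Any.toSum

mutual
  collapse : ∀ {c P} → Deriv false P → (Γ : Seq) → Pi1Seq Γ → P ⊆ (_∈ Γ) → Der (BI0rules c) Γ
  collapse (axTrue A p t) Γ π P⊆Γ =
    node (axT A t) (λ { refl → P⊆Γ p }) tt (λ ()) (λ ()) (λ ())
  collapse (axNeg C p p′) Γ π P⊆Γ =
    node (axC C) (λ { (inj₁ refl) → P⊆Γ p ; (inj₂ refl) → P⊆Γ p′ }) tt (λ ()) (λ ()) (λ ())
  collapse (andR A B p d) Γ π P⊆Γ =
    node (andI A B) (λ { refl → P⊆Γ p }) tt _
         (λ k → collapse-∷ (d k) Γ (Pi1-pick k (lookup π (P⊆Γ p))) π P⊆Γ) (λ _ → ∷-minor)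
  collapse (orR A B k p d) Γ π P⊆Γ =
    node (orI k A B) (λ { refl → P⊆Γ p }) tt _
         (λ _ → collapse-∷ d Γ (Pi1-pick k (lookup π (P⊆Γ p))) π P⊆Γ) (λ _ → ∷-minor)
  collapse (allR A p d) Γ π P⊆Γ =
    node (allI A) (λ { refl → P⊆Γ p }) tt _
         (λ n → collapse-∷ (d n) Γ (Pi1-subF _ A (lookup π (P⊆Γ p))) π P⊆Γ) (λ _ → ∷-minor)
  collapse (exR A n p d) Γ π P⊆Γ =
    node (exI n A) (λ { refl → P⊆Γ p }) tt _
         (λ _ → collapse-∷ d Γ (Pi1-subF _ A (lookup π (P⊆Γ p))) π P⊆Γ) (λ _ → ∷-minor)
  collapse (all2R A L p d) Γ π P⊆Γ =
    node (all2I A (freshFor L Γ)) (λ { refl → P⊆Γ p }) (freshFor-NotFreeIn L Γ) _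
         (λ _ → collapse-∷ (d _ (freshFor∉ L Γ)) Γ (Pi1-inst _ A) π P⊆Γ) (λ _ → ∷-minor)
  collapse (omegaR A p d) Γ π P⊆Γ = ⊥-elim (lookup π (P⊆Γ p))
  collapse (omegaTR A L d e) Γ π P⊆Γ = collapse (e q) Γ π ([ P⊆Γ , Δq⊆Γ ])
    where
    Y : SVar
    Y = freshFor L Γ
    q : OmIdx A
    q = record
      { Γe   = inst Y A ∷ Γ
      ; e    = collapse-∷ (d Y (freshFor∉ L Γ)) Γ (Pi1-inst Y A) π P⊆Γ
      ; pi1  = Pi1-inst Y A ∷ π
      ; Z    = Y
      ; free = λ { _ (here e) B≢ → ⊥-elim (B≢ e)
                 ; _ (there B∈) _ → lookup (freshFor-NotFreeIn L Γ) B∈ } }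
    Δq⊆Γ : Δq A q ⊆ (_∈ Γ)
    Δq⊆Γ (here e , B≢)  = ⊥-elim (B≢ e)
    Δq⊆Γ (there B∈ , _) = B∈

  collapse-∷ : ∀ {c P A} → Deriv false (P ∪ ｛ A ｝) → (Γ : Seq) → Pi1 A → Pi1Seq Γ → P ⊆ (_∈ Γ)
             → Der (BI0rules c) (A ∷ Γ)
  collapse-∷ d Γ πA π P⊆Γ = collapse d _ (πA ∷ π) ([ there ∘ P⊆Γ , here ∘ sym ])

corollary1 : (Γ : Seq) → Der BIΩ Γ → Pi1Seq Γ → Der BI0 Γ
corollary1 Γ d π = collapse (eliminate-cuts (embed ↔-refl d Γ⟨id⟩⊆Γ)) Γ π id
  where
  Γ⟨id⟩⊆Γ : Γ ⟨ id ⟩⊆ (_∈ Γ)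
  Γ⟨id⟩⊆Γ = mk⟨⟩⊆ λ {B} → subst (_∈ Γ) (sym (rename-id B))
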